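{- For all integers $a,b,c,d$: $a:b::_{SY}c:d$ if and only if $a:b::_{(\mathbb Z,+,\mathbb Z),m}c:d$.
   Context: $a:b::_{SY}c:d$ means: there exist $k,\ell,o,u\in\mathbb Z$ with $a=k+o$, $b=\ell+o$, $c=k+u$, $d=\ell+u$. $(\mathbb Z,+,\mathbb Z)$ is the algebra with universe $\mathbb Z$, binary operation $+$ and a constant symbol for every integer. A justification is a pair of terms $s\to t$ with every variable of $t$ occurring in $s$; $\uparrow(a\to b)$ is the set of justifications with $a=s(\mathbf o)$, $b=t(\mathbf o)$ (evaluated in the algebra) for some assignment $\mathbf o$ of integers to the variables. $\uparrow^m(a\to b)$ keeps those whose terms contain only a single fixed variable $x$, occurring at most once on each side. $\uparrow^m(a\to b:\!\cdot\,c\to d):=\uparrow^m(a\to b)\cap\uparrow^m(c\to d)$; a monolinear justification is trivial if it lies in all such sets. $a\to b:\!\cdot_m\,c\to d$ holds iff either (a) $\uparrow^m(a\to b)\cup\uparrow^m(c\to d)$ consists only of trivial justifications, or (b) with $J_e$ denoting $\uparrow^m(a\to b:\!\cdot\,c\to e)$ minus trivial justifications, $J_d\neq\emptyset$ and $J_d\subseteq J_{d'}$ implies $J_{d'}\subseteq J_d$ for every integer $d'$. Then $a:b::_{(\mathbb Z,+,\mathbb Z),m}c:d$ iff $a\to b:\!\cdot_m\,c\to d$, $b\to a:\!\cdot_m\,d\to c$, $c\to d:\!\cdot_m\,a\to b$, $d\to c:\!\cdot_m\,b\to a$ all hold. -}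

module Defs where

open import Data.Nat using (ℕ; zero; suc; _≤_; _<_)
import Data.Nat as ℕ
open import Data.Integer using (ℤ; _+_)
open import Data.Product using (Σ; ∃; _×_; _,_)
open import Data.Sum using (_⊎_)
open import Relation.Nullary using (¬_)
open import Relation.Binary.PropositionalEquality using (_≡_)

SY : ℤ → ℤ → ℤ → ℤ → Set
SY a b c d = Σ ℤ λ k → Σ ℤ λ ℓ → Σ ℤ λ o → Σ ℤ λ u →
  (a ≡ k + o) × (b ≡ ℓ + o) × (c ≡ k + u) × (d ≡ ℓ + u)

-- Terms of the algebra (ℤ,+,ℤ) over the single fixed variable x:
-- the variable, a constant symbol for every integer, and binary +.
data Term : Set where
  x     : Term
  const : ℤ → Term
  _⊕_   : Term → Term → Term

eval : Term → ℤ → ℤ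
eval x         o = o
eval (const z) o = z
eval (s ⊕ t)   o = eval s o + eval t o

occ : Term → ℕ
occ x         = 1
occ (const _) = 0
occ (s ⊕ t)   = occ s ℕ.+ occ t

-- s → t is a monolinear justification: terms only in x, x at most once
-- on each side, and every variable of t occurs in s.
Monolinear : Term → Term → Set
Monolinear s t = (occ s ≤ 1) × (occ t ≤ 1) × (0 < occ t → 0 < occ s)

Up : ℤ → ℤ → Term → Term → Set
Up a b s t = Monolinear s t × (Σ ℤ λ o → (eval s o ≡ a) × (eval t o ≡ b))

UpP : ℤ → ℤ → ℤ → ℤ → Term → Term → Set
UpP a b c d s t = Up a b s t × Up c d s t

Trivial : Term → Term → Set
Trivial s t = Monolinear s t × (∀ a b c d → UpP a b c d s t)

J : ℤ → ℤ → ℤ → ℤ → Term → Term → Set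
J a b c e s t = UpP a b c e s t × ¬ Trivial s t

Arrow : ℤ → ℤ → ℤ → ℤ → Set
Arrow a b c d =
  (∀ s t → (Up a b s t ⊎ Up c d s t) → Trivial s t)
  ⊎ ((Σ Term λ s → Σ Term λ t → J a b c d s t)
     × (∀ d' → (∀ s t → J a b c d s t → J a b c d' s t)
             → (∀ s t → J a b c d' s t → J a b c d s t)))

Analogy : ℤ → ℤ → ℤ → ℤ → Set
Analogy a b c d =
  Arrow a b c d × Arrow b a d c × Arrow c d a b × Arrow d c b a

-- A monolinear term in the single variable x evaluates either to a constant or to
-- x plus a constant. Hence a justification shared by a → b and c → d is either a
-- translation, forcing b − a = d − c, or has a constant right-hand side, forcing
-- b = d. In particular no justification is trivial, so each arrow a → b :·ₘ c → d
-- yields a shared justification; the arrows a → b :·ₘ c → d and b → a :·ₘ d → c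
-- together force b − a = d − c, which is exactly a:b::_{SY}c:d. Conversely the
-- translation x → x + (b − a) witnesses every arrow, and J_d is maximal because
-- this one justification already determines d from c.
module Submission where

open import Defs
open import Data.Empty using (⊥-elim)
open import Data.Integer using (ℤ; +_; 0ℤ; 1ℤ; _+_; _-_; -_; _*_)
open import Data.Integer.Properties
  using (pos-+; +-identityˡ; +-identityʳ; *-identityˡ; *-zeroˡ; +-0-abelianGroup)
open import Data.Integer.Tactic.RingSolver using (solve-∀)
open import Data.Nat using (z≤n; s≤s)
import Data.Nat as ℕ
open import Data.Nat.Properties using (≤-antisym; ≤-reflexive)
open import Data.Product using (Σ; _,_; proj₁; proj₂)
open import Data.Sum using (_⊎_; inj₁; inj₂)
open import Function using (case_of_)
open import Function.Bundles using (_⇔_; mk⇔; Equivalence)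
open import Relation.Binary.PropositionalEquality
  using (_≡_; refl; sym; trans; cong; cong₂; module ≡-Reasoning)
open import Relation.Nullary using (¬_)
open import Algebra.Bundles using (AbelianGroup)
open import Algebra.Properties.Group (AbelianGroup.group +-0-abelianGroup) using (∙-cancelʳ)

open ≡-Reasoning

private
  variable
    a b c d d' : ℤ

eval-affine : ∀ s o → eval s o ≡ + occ s * o + eval s 0ℤ
eval-affine x o = begin
  o               ≡⟨ *-identityˡ o ⟨
  1ℤ * o          ≡⟨ +-identityʳ (1ℤ * o) ⟨
  1ℤ * o + 0ℤ     ∎
eval-affine (const z) o = begin
  z               ≡⟨ +-identityˡ z ⟨
  0ℤ + z          ≡⟨ cong (_+ z) (*-zeroˡ o) ⟨
  0ℤ * o + z      ∎
eval-affine (s ⊕ t) o = begin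
  eval s o + eval t o
    ≡⟨ cong₂ _+_ (eval-affine s o) (eval-affine t o) ⟩
  (+ occ s * o + eval s 0ℤ) + (+ occ t * o + eval t 0ℤ)
    ≡⟨ collect (+ occ s) (+ occ t) o (eval s 0ℤ) (eval t 0ℤ) ⟩
  (+ occ s + + occ t) * o + (eval s 0ℤ + eval t 0ℤ)
    ≡⟨ cong (λ n → n * o + (eval s 0ℤ + eval t 0ℤ)) (pos-+ (occ s) (occ t)) ⟨
  + (occ s ℕ.+ occ t) * o + (eval s 0ℤ + eval t 0ℤ)
    ∎
  where
  collect : ∀ m n o p q → (m * o + p) + (n * o + q) ≡ (m + n) * o + (p + q)
  collect = solve-∀

eval-constant : ∀ s → occ s ≡ 0 → ∀ o → eval s o ≡ eval s 0ℤ
eval-constant s occ≡0 o = begin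
  eval s o                 ≡⟨ eval-affine s o ⟩
  + occ s * o + eval s 0ℤ  ≡⟨ cong (λ n → + n * o + eval s 0ℤ) occ≡0 ⟩
  0ℤ * o + eval s 0ℤ       ≡⟨ cong (_+ eval s 0ℤ) (*-zeroˡ o) ⟩
  0ℤ + eval s 0ℤ           ≡⟨ +-identityˡ (eval s 0ℤ) ⟩
  eval s 0ℤ                ∎

eval-translation : ∀ s → occ s ≡ 1 → ∀ o → eval s o ≡ o + eval s 0ℤ
eval-translation s occ≡1 o = begin
  eval s o                 ≡⟨ eval-affine s o ⟩
  + occ s * o + eval s 0ℤ  ≡⟨ cong (λ n → + n * o + eval s 0ℤ) occ≡1 ⟩
  1ℤ * o + eval s 0ℤ       ≡⟨ cong (_+ eval s 0ℤ) (*-identityˡ o) ⟩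
  o + eval s 0ℤ            ∎

translation-difference : ∀ s t → occ s ≡ 1 → occ t ≡ 1 →
                         ∀ o → eval t o - eval s o ≡ eval t 0ℤ - eval s 0ℤ
translation-difference s t occs≡1 occt≡1 o = begin
  eval t o - eval s o
    ≡⟨ cong₂ _-_ (eval-translation t occt≡1 o) (eval-translation s occs≡1 o) ⟩
  (o + eval t 0ℤ) - (o + eval s 0ℤ)
    ≡⟨ cancel o (eval t 0ℤ) (eval s 0ℤ) ⟩
  eval t 0ℤ - eval s 0ℤ
    ∎
  where
  cancel : ∀ o p q → (o + p) - (o + q) ≡ p - q
  cancel = solve-∀

≤1⇒≡0⊎≡1 : ∀ {n} → n ℕ.≤ 1 → n ≡ 0 ⊎ n ≡ 1
≤1⇒≡0⊎≡1 z≤n       = inj₁ refl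
≤1⇒≡0⊎≡1 (s≤s z≤n) = inj₂ refl

Monolinear⇒source-linear : ∀ s t → Monolinear s t → occ t ≡ 1 → occ s ≡ 1
Monolinear⇒source-linear _ _ (occs≤1 , _ , t⇒s) occt≡1 =
  ≤-antisym occs≤1 (t⇒s (≤-reflexive (sym occt≡1)))

UpP⇒translation⊎constant : ∀ s t → UpP a b c d s t → b - a ≡ d - c ⊎ b ≡ d
UpP⇒translation⊎constant s t
  ((monolinear@(_ , occt≤1 , _) , o , refl , refl) , (_ , o' , refl , refl))
  with ≤1⇒≡0⊎≡1 occt≤1
... | inj₁ occt≡0 = inj₂ (trans (eval-constant t occt≡0 o) (sym (eval-constant t occt≡0 o')))
... | inj₂ occt≡1 = inj₁ (trans (translation-difference s t occs≡1 occt≡1 o)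
                                (sym (translation-difference s t occs≡1 occt≡1 o')))
  where occs≡1 = Monolinear⇒source-linear s t monolinear occt≡1

UpP-functional : ∀ s t → UpP c d c d' s t → d ≡ d'
UpP-functional {c} {d} {d'} s t j with UpP⇒translation⊎constant s t j
... | inj₁ d-c≡d'-c = ∙-cancelʳ (- c) d d' d-c≡d'-c
... | inj₂ d≡d'     = d≡d'

¬Trivial : ∀ s t → ¬ Trivial s t
¬Trivial s t (_ , inAll) = case UpP-functional s t (inAll 0ℤ 0ℤ 0ℤ 1ℤ) of λ ()

Arrow⇒UpP : Arrow a b c d → Σ Term λ s → Σ Term λ t → UpP a b c d s t
Arrow⇒UpP {a} {b} (inj₁ onlyTrivial) =
  ⊥-elim (¬Trivial (const a) (const b) (onlyTrivial (const a) (const b)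
                          (inj₁ ((z≤n , z≤n , λ ()) , 0ℤ , refl , refl))))
Arrow⇒UpP (inj₂ ((s , t , j , _) , _)) = s , t , j

Arrow⇒translation⊎constant : Arrow a b c d → b - a ≡ d - c ⊎ b ≡ d
Arrow⇒translation⊎constant arrow with Arrow⇒UpP arrow
... | s , t , j = UpP⇒translation⊎constant s t j

plus-difference : ∀ a b → a + (b - a) ≡ b
plus-difference = solve-∀

translation⇒Arrow : b - a ≡ d - c → Arrow a b c d
translation⇒Arrow {b} {a} {d} {c} b-a≡d-c =
  inj₂ ((x , shift , j , ¬Trivial x shift) , maximal)
  where
  shift : Term
  shift = x ⊕ const (b - a)

  monolinear : Monolinear x shift
  monolinear = s≤s z≤n , s≤s z≤n , λ _ → s≤s z≤n

  j : UpP a b c d x shift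
  j = (monolinear , a , refl , plus-difference a b)
    , (monolinear , c , refl , trans (cong (λ e → c + e) b-a≡d-c) (plus-difference c d))

  maximal : ∀ d' → (∀ s t → J a b c d s t → J a b c d' s t)
                 → (∀ s t → J a b c d' s t → J a b c d s t)
  maximal d' J⊆J' with UpP-functional x shift (proj₂ j , proj₂ (proj₁ (J⊆J' x shift (j , ¬Trivial x shift))))
  ... | refl = λ _ _ j' → j'

swap-differences : ∀ a b c d → b - a ≡ d - c → a - b ≡ c - d
swap-differences a b c d b-a≡d-c = begin
  a - b      ≡⟨ neg-difference a b ⟩
  - (b - a)  ≡⟨ cong -_ b-a≡d-c ⟩
  - (d - c)  ≡⟨ neg-difference c d ⟨
  c - d      ∎
  where
  neg-difference : ∀ a b → a - b ≡ - (b - a)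
  neg-difference = solve-∀

SY⇔translation : SY a b c d ⇔ (b - a ≡ d - c)
SY⇔translation {a} {b} {c} {d} = mk⇔ to from
  where
  to : SY a b c d → b - a ≡ d - c
  to (k , ℓ , o , u , refl , refl , refl , refl) =
    trans (cancel ℓ k o) (sym (cancel ℓ k u))
    where
    cancel : ∀ ℓ k o → (ℓ + o) - (k + o) ≡ ℓ - k
    cancel = solve-∀

  from : b - a ≡ d - c → SY a b c d
  from b-a≡d-c = a , b , 0ℤ , c - a
    , sym (+-identityʳ a) , sym (+-identityʳ b) , sym (plus-difference a c)
    , (begin
        d              ≡⟨ plus-difference c d ⟨
        c + (d - c)    ≡⟨ cong (λ e → c + e) b-a≡d-c ⟨
        c + (b - a)    ≡⟨ exchange a b c ⟩
        b + (c - a)    ∎)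
    where
    exchange : ∀ a b c → c + (b - a) ≡ b + (c - a)
    exchange = solve-∀

mainTheorem7 : (a b c d : ℤ) → SY a b c d ⇔ Analogy a b c d
mainTheorem7 a b c d = mk⇔ to from
  where
  open Equivalence (SY⇔translation {a} {b} {c} {d}) renaming (to to SY⇒; from to ⇒SY)

  to : SY a b c d → Analogy a b c d
  to sy = translation⇒Arrow Δ
        , translation⇒Arrow (swap-differences a b c d Δ)
        , translation⇒Arrow (sym Δ)
        , translation⇒Arrow (sym (swap-differences a b c d Δ))
    where Δ = SY⇒ sy

  from : Analogy a b c d → SY a b c d
  from (ab:cd , ba:dc , _) with Arrow⇒translation⊎constant ab:cd
                              | Arrow⇒translation⊎constant ba:dc
  ... | inj₁ b-a≡d-c | _            = ⇒SY b-a≡d-c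
  ... | inj₂ _       | inj₁ a-b≡c-d = ⇒SY (swap-differences b a d c a-b≡c-d)
  ... | inj₂ refl    | inj₂ refl    = ⇒SY refl
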